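{- If $|X|=4p-3$ and $(p, X)=0$, then $(p-1, X)\equiv (3p-1, X) \pmod p$.
   Context: Let $p$ be an odd prime and let $X$ be a finite set of lattice points in the Euclidean plane. For a positive integer $n$, $(n, X)$ denotes the number of $n$-element subsets of $X$ the sum of whose elements (taken coordinatewise) is divisible by $p$, i.e. is $\equiv (0,0) \pmod p$. -}

module Defs where

open import Data.Nat using (ℕ; zero; suc; _≟_)
open import Data.Integer using (ℤ; +_; _+_)
open import Data.Integer.Divisibility using (_∣_)
open import Data.Nat.Divisibility using (_∣?_)
open import Data.Product using (_×_; _,_; proj₁; proj₂)
open import Data.List using (List; []; _∷_; length; map; _++_; filter; foldr)
open import Relation.Nullary using (Dec; yes; no)
open import Relation.Nullary.Decidable using (_×-dec_)

Point : Set
Point = ℤ × ℤ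

sumPts : List Point → Point
sumPts = foldr (λ x s → (proj₁ x + proj₁ s , proj₂ x + proj₂ s)) (+ 0 , + 0)

-- all sub-lists (sub-selections) of a list; for a list without repetitions
-- these are exactly the subsets of the underlying finite set
sublists : {A : Set} → List A → List (List A)
sublists [] = [] ∷ []
sublists (x ∷ xs) = let s = sublists xs in s ++ map (x ∷_) s

sumDivBy : ℕ → Point → Set
sumDivBy p (a , b) = ((+ p) ∣ a) × ((+ p) ∣ b)

sumDivBy? : (p : ℕ) (v : Point) → Dec (sumDivBy p v)
sumDivBy? p (a , b) = (p ∣? Data.Integer.∣ a ∣) ×-dec (p ∣? Data.Integer.∣ b ∣)

-- (n , X) : number of n-element subsets of X whose sum is ≡ (0,0) mod p
count : (p n : ℕ) → List Point → ℕ
count p n X = length (filter (λ S → (length S ≟ n) ×-dec sumDivBy? p (sumPts S)) (sublists X))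

module Submission where

-- The polynomial Q(x) = (x − 1)(x − 2)⋯(x − (p − 1)) is ≡ Q(0)·[p ∣ x] mod p with p ∤ Q(0), so the product
-- of Q at the three coordinates of (|Z|, ΣZ) is a polynomial of degree 3(p − 1) detecting "|Z| and ΣZ are
-- ≡ 0 mod p". Its alternating sum over the sub-selections Z of a list Y vanishes once |Y| > 3(p − 1)
-- (Chevalley–Warning by finite differences). When moreover |Y| < 3p and Y has no zero-sum p-subset,
-- only |Z| ∈ {0, 2p} survive, so Y has ≡ −1 zero-sum 2p-subsets mod p.
-- Now count pairs (A, C) of disjoint zero-sum subsets of X with |A| = p − 1 and |C| = 2p. Grouping by A,
-- C runs through the 2p-subsets of the (3p − 2)-element complement of A, giving ≡ −(p − 1, X); grouping
-- by B = A ∪ C, a zero-sum (3p − 1)-set, C runs through the 2p-subsets of B, giving ≡ −(3p − 1, X).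

open import Algebra.Structures using (IsCommutativeMonoid)
open import Data.Empty using (⊥-elim)
open import Data.Integer using (ℤ; +_; 0ℤ; 1ℤ; -1ℤ; -_; _+_; _-_; _^_; ∣_∣) renaming (_*_ to _·_)
open import Data.Integer.Divisibility using (_∣_)
import Data.Integer.Divisibility.Signed as Signed
import Data.Integer.DivMod as ℤ
import Data.Integer.Properties as ℤ
open import Data.Integer.Tactic.RingSolver using (solve-∀)
open import Data.List using (List; []; _∷_; length; map; _++_; filter)
open import Data.List.Membership.Propositional using (_∈_)
open import Data.List.Membership.Propositional.Properties using (∈-map⁺; ∈-map⁻; ∈-++⁺ˡ; ∈-++⁺ʳ; ∈-++⁻)
open import Data.List.Properties using (map-++; map-∘; filter-some)
open import Data.List.Relation.Binary.Sublist.Propositional using (_⊆_; []; _∷_; _∷ʳ_; ⊆-trans)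
open import Data.List.Relation.Binary.Sublist.Propositional.Properties using (length-mono-≤)
open import Data.List.Relation.Ternary.Interleaving.Propositional using (Interleaving; []; _∷ˡ_; _∷ʳ_)
import Data.List.Relation.Ternary.Interleaving.Propositional as Interleaving
open import Data.List.Relation.Unary.Any using (here; there)
import Data.List.Relation.Unary.Any as Any
open import Data.List.Relation.Unary.Unique.Propositional using (Unique)
open import Data.Nat using (ℕ; zero; suc; _*_; _∸_; _≤_; _<_; z≤n; s≤s; _≟_) renaming (_+_ to _+ℕ_)
import Data.Nat.Base as ℕ
open import Data.Nat.Divisibility using (_∣?_)
import Data.Nat.Divisibility as ℕ
open import Data.Nat.Primality using (Prime; euclidsLemma; prime⇒nonTrivial; prime⇒nonZero)
import Data.Nat.Properties as ℕ
import Data.Nat.Tactic.RingSolver as ℕ-Solver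
open import Data.Product using (_×_; _,_; proj₁; proj₂; map₁; map₂; uncurry)
open import Data.Sum using (_⊎_; inj₁; inj₂)
open import Defs
open import Level using (0ℓ)
open import Relation.Binary.Bundles using (Setoid)
import Relation.Binary.PropositionalEquality as Eq
open import Relation.Binary.PropositionalEquality using (_≡_; _≢_; refl; sym; trans; cong; cong₂; subst; subst₂; module ≡-Reasoning)
import Relation.Binary.Reasoning.Setoid
open import Relation.Nullary using (Dec; yes; no; ¬_)
open import Relation.Nullary.Decidable using (_×-dec_)
open import Relation.Unary using (Pred; Decidable)

private
  variable
    A : Set

𝟙 : {P : Set} → Dec P → ℤ
𝟙 (yes _) = 1ℤ
𝟙 (no _) = 0ℤ

𝟙-yes : {P : Set} (p? : Dec P) → P → 𝟙 p? ≡ 1ℤ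
𝟙-yes (yes _) _ = refl
𝟙-yes (no ¬p) p = ⊥-elim (¬p p)

𝟙-no : {P : Set} (p? : Dec P) → ¬ P → 𝟙 p? ≡ 0ℤ
𝟙-no (yes p) ¬p = ⊥-elim (¬p p)
𝟙-no (no _) _ = refl

𝟙-×-dec : {P Q : Set} (p? : Dec P) (q? : Dec Q) → 𝟙 (p? ×-dec q?) ≡ 𝟙 p? · 𝟙 q?
𝟙-×-dec (yes _) (yes _) = refl
𝟙-×-dec (yes _) (no _) = refl
𝟙-×-dec (no _) (yes _) = refl
𝟙-×-dec (no _) (no _) = refl

𝟙-cong : {P Q : Set} (p? : Dec P) (q? : Dec Q) → (P → Q) → (Q → P) → 𝟙 p? ≡ 𝟙 q?
𝟙-cong (yes p) q? to from = sym (𝟙-yes q? (to p))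
𝟙-cong (no ¬p) q? to from = sym (𝟙-no q? (λ q → ¬p (from q)))

∑ : List A → (A → ℤ) → ℤ
∑ [] f = 0ℤ
∑ (x ∷ xs) f = f x + ∑ xs f

syntax ∑ xs (λ x → e) = ∑[ x ∈ xs ] e

∑-++ : (xs ys : List A) (f : A → ℤ) → ∑ (xs ++ ys) f ≡ ∑ xs f + ∑ ys f
∑-++ [] ys f = sym (ℤ.+-identityˡ _)
∑-++ (x ∷ xs) ys f = trans (cong (_+_ (f x)) (∑-++ xs ys f)) (sym (ℤ.+-assoc (f x) _ _))

∑-map : {B : Set} (g : A → B) (xs : List A) (f : B → ℤ) → ∑ (map g xs) f ≡ ∑[ x ∈ xs ] f (g x)
∑-map g [] f = refl
∑-map g (x ∷ xs) f = cong (_+_ (f (g x))) (∑-map g xs f)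

∑-cong : (xs : List A) {f g : A → ℤ} → (∀ {x} → x ∈ xs → f x ≡ g x) → ∑ xs f ≡ ∑ xs g
∑-cong [] eq = refl
∑-cong (x ∷ xs) eq = cong₂ _+_ (eq (here refl)) (∑-cong xs (λ x∈xs → eq (there x∈xs)))

∑-distrib-+ : (xs : List A) (f g : A → ℤ) → ∑[ x ∈ xs ] (f x + g x) ≡ ∑ xs f + ∑ xs g
∑-distrib-+ [] f g = refl
∑-distrib-+ (x ∷ xs) f g = trans (cong (_+_ (f x + g x)) (∑-distrib-+ xs f g)) (interchange (f x) (g x) _ _)
  where
  interchange : ∀ a b c d → (a + b) + (c + d) ≡ (a + c) + (b + d)
  interchange = solve-∀

∑-zero : (xs : List A) → ∑[ x ∈ xs ] 0ℤ ≡ 0ℤ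
∑-zero [] = refl
∑-zero (_ ∷ xs) = trans (ℤ.+-identityˡ _) (∑-zero xs)

*-distribˡ-∑ : (k : ℤ) (xs : List A) (f : A → ℤ) → k · ∑ xs f ≡ ∑[ x ∈ xs ] (k · f x)
*-distribˡ-∑ k [] f = ℤ.*-zeroʳ k
*-distribˡ-∑ k (x ∷ xs) f = trans (ℤ.*-distribˡ-+ k (f x) _) (cong (_+_ (k · f x)) (*-distribˡ-∑ k xs f))

length-filter-∑ : {P : Pred A 0ℓ} (P? : Decidable P) (xs : List A) →
  + length (filter P? xs) ≡ ∑[ x ∈ xs ] 𝟙 (P? x)
length-filter-∑ P? [] = refl
length-filter-∑ P? (x ∷ xs) with P? x
... | yes _ = cong (_+_ 1ℤ) (length-filter-∑ P? xs)
... | no _ = trans (length-filter-∑ P? xs) (sym (ℤ.+-identityˡ _))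

splits : List A → List (List A × List A)
splits [] = ([] , []) ∷ []
splits (x ∷ xs) = map (map₂ (x ∷_)) (splits xs) ++ map (map₁ (x ∷_)) (splits xs)

∑-splits : (x : A) (xs : List A) (g : List A → List A → ℤ) →
  ∑ (splits (x ∷ xs)) (uncurry g) ≡ ∑ (splits xs) (λ (ys , zs) → g ys (x ∷ zs)) + ∑ (splits xs) (λ (ys , zs) → g (x ∷ ys) zs)
∑-splits x xs g = begin
  ∑ (splits (x ∷ xs)) (uncurry g)
    ≡⟨ ∑-++ (map (map₂ (x ∷_)) (splits xs)) _ (uncurry g) ⟩
  ∑ (map (map₂ (x ∷_)) (splits xs)) (uncurry g) + ∑ (map (map₁ (x ∷_)) (splits xs)) (uncurry g)
    ≡⟨ cong₂ _+_ (∑-map (map₂ (x ∷_)) (splits xs) (uncurry g)) (∑-map (map₁ (x ∷_)) (splits xs) (uncurry g)) ⟩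
  ∑ (splits xs) (λ (ys , zs) → g ys (x ∷ zs)) + ∑ (splits xs) (λ (ys , zs) → g (x ∷ ys) zs) ∎
  where open ≡-Reasoning

map-proj₁-splits : (xs : List A) → map proj₁ (splits xs) ≡ sublists xs
map-proj₁-splits [] = refl
map-proj₁-splits (x ∷ xs) = begin
  map proj₁ (map (map₂ (x ∷_)) (splits xs) ++ map (map₁ (x ∷_)) (splits xs))
    ≡⟨ map-++ proj₁ (map (map₂ (x ∷_)) (splits xs)) _ ⟩
  map proj₁ (map (map₂ (x ∷_)) (splits xs)) ++ map proj₁ (map (map₁ (x ∷_)) (splits xs))
    ≡⟨ cong₂ _++_ (sym (map-∘ (splits xs))) (trans (sym (map-∘ (splits xs))) (map-∘ (splits xs))) ⟩
  map proj₁ (splits xs) ++ map (x ∷_) (map proj₁ (splits xs))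
    ≡⟨ cong (λ s → s ++ map (x ∷_) s) (map-proj₁-splits xs) ⟩
  sublists xs ++ map (x ∷_) (sublists xs) ∎
  where open ≡-Reasoning

∑-splits-proj₁ : (xs : List A) (f : List A → ℤ) → ∑ (splits xs) (λ (ys , _) → f ys) ≡ ∑ (sublists xs) f
∑-splits-proj₁ xs f = trans (sym (∑-map proj₁ (splits xs) f)) (cong (λ s → ∑ s f) (map-proj₁-splits xs))

∑-splits-swap : (xs : List A) (g : List A → List A → ℤ) →
  ∑ (splits xs) (λ (ys , zs) → g ys zs) ≡ ∑ (splits xs) (λ (ys , zs) → g zs ys)
∑-splits-swap [] g = refl
∑-splits-swap (x ∷ xs) g = begin
  ∑ (splits (x ∷ xs)) (uncurry g)
    ≡⟨ ∑-splits x xs g ⟩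
  ∑ (splits xs) (λ (ys , zs) → g ys (x ∷ zs)) + ∑ (splits xs) (λ (ys , zs) → g (x ∷ ys) zs)
    ≡⟨ cong₂ _+_ (∑-splits-swap xs (λ ys zs → g ys (x ∷ zs))) (∑-splits-swap xs (λ ys zs → g (x ∷ ys) zs)) ⟩
  s₁ + s₂
    ≡⟨ ℤ.+-comm s₁ s₂ ⟩
  s₂ + s₁
    ≡⟨ sym (∑-splits x xs (λ ys zs → g zs ys)) ⟩
  ∑ (splits (x ∷ xs)) (λ (ys , zs) → g zs ys) ∎
  where
  open ≡-Reasoning
  s₁ s₂ : ℤ
  s₁ = ∑ (splits xs) (λ (ys , zs) → g zs (x ∷ ys))
  s₂ = ∑ (splits xs) (λ (ys , zs) → g (x ∷ zs) ys)

∑-splits-assoc : (xs : List A) (g : List A → List A → List A → ℤ) →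
  ∑ (splits xs) (λ (us , vws) → ∑ (splits vws) (λ (vs , ws) → g us vs ws)) ≡
  ∑ (splits xs) (λ (uvs , ws) → ∑ (splits uvs) (λ (us , vs) → g us vs ws))
∑-splits-assoc [] g = refl
∑-splits-assoc {A = A} (x ∷ xs) g = begin
  ∑ (splits (x ∷ xs)) (inner g)
    ≡⟨ ∑-splits x xs (λ us vws → inner g (us , vws)) ⟩
  ∑ (splits xs) (λ (us , vws) → inner g (us , x ∷ vws)) + L gᵘ
    ≡⟨ cong₂ _+_ (trans (∑-cong (splits xs) (λ {(us , vws)} _ → ∑-splits x vws (g us)))
                        (∑-distrib-+ (splits xs) (inner gʷ) (inner gᵛ))) refl ⟩
  (L gʷ + L gᵛ) + L gᵘ
    ≡⟨ ℤ.+-assoc (L gʷ) (L gᵛ) (L gᵘ) ⟩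
  L gʷ + (L gᵛ + L gᵘ)
    ≡⟨ cong₂ _+_ (∑-splits-assoc xs gʷ) (cong₂ _+_ (∑-splits-assoc xs gᵛ) (∑-splits-assoc xs gᵘ)) ⟩
  R gʷ + (R gᵛ + R gᵘ)
    ≡⟨ cong (_+_ (R gʷ)) (trans (sym (∑-distrib-+ (splits xs) (outer gᵛ) (outer gᵘ)))
                             (∑-cong (splits xs) (λ {(uvs , ws)} _ → sym (∑-splits x uvs (λ us vs → g us vs ws))))) ⟩
  R gʷ + ∑ (splits xs) (λ (uvs , ws) → outer g (x ∷ uvs , ws))
    ≡⟨ sym (∑-splits x xs (λ uvs ws → outer g (uvs , ws))) ⟩
  ∑ (splits (x ∷ xs)) (outer g) ∎
  where
  open ≡-Reasoning
  inner outer : (List A → List A → List A → ℤ) → List A × List A → ℤ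
  inner h (us , vws) = ∑ (splits vws) (λ (vs , ws) → h us vs ws)
  outer h (uvs , ws) = ∑ (splits uvs) (λ (us , vs) → h us vs ws)
  L R : (List A → List A → List A → ℤ) → ℤ
  L h = ∑ (splits xs) (inner h)
  R h = ∑ (splits xs) (outer h)
  gᵘ gᵛ gʷ : List A → List A → List A → ℤ
  gᵘ us vs ws = g (x ∷ us) vs ws
  gᵛ us vs ws = g us (x ∷ vs) ws
  gʷ us vs ws = g us vs (x ∷ ws)

∈-splits⇒Interleaving : {xs ys zs : List A} → (ys , zs) ∈ splits xs → Interleaving ys zs xs
∈-splits⇒Interleaving {xs = []} (here refl) = []
∈-splits⇒Interleaving {xs = x ∷ xs} mem with ∈-++⁻ (map (map₂ (x ∷_)) (splits xs)) mem
... | inj₁ mem₂ with ∈-map⁻ (map₂ (x ∷_)) mem₂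
...   | (_ , mem′ , refl) = refl ∷ʳ ∈-splits⇒Interleaving mem′
∈-splits⇒Interleaving {xs = x ∷ xs} mem | inj₂ mem₁ with ∈-map⁻ (map₁ (x ∷_)) mem₁
...   | (_ , mem′ , refl) = refl ∷ˡ ∈-splits⇒Interleaving mem′

Interleaving⇒⊆ˡ : {xs ys zs : List A} → Interleaving ys zs xs → ys ⊆ xs
Interleaving⇒⊆ˡ [] = []
Interleaving⇒⊆ˡ (refl ∷ˡ sp) = refl ∷ Interleaving⇒⊆ˡ sp
Interleaving⇒⊆ˡ (_∷ʳ_ {c = x} _ sp) = x ∷ʳ Interleaving⇒⊆ˡ sp

∈-sublists⇒⊆ : {xs ys : List A} → ys ∈ sublists xs → ys ⊆ xs
∈-sublists⇒⊆ {xs = xs} mem with ∈-map⁻ proj₁ (subst (_ ∈_) (sym (map-proj₁-splits xs)) mem)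
... | (_ , mem′ , refl) = Interleaving⇒⊆ˡ (∈-splits⇒Interleaving mem′)

⊆⇒∈-sublists : {xs ys : List A} → ys ⊆ xs → ys ∈ sublists xs
⊆⇒∈-sublists [] = here refl
⊆⇒∈-sublists (y ∷ʳ τ) = ∈-++⁺ˡ (⊆⇒∈-sublists τ)
⊆⇒∈-sublists {xs = x ∷ xs} (refl ∷ τ) = ∈-++⁺ʳ (sublists xs) (∈-map⁺ (x ∷_) (⊆⇒∈-sublists τ))

infix 4 _≡_mod_
-- A record rather than a synonym for divisibility, so that a and b can be inferred from the type.
record _≡_mod_ (a b : ℤ) (n : ℕ) : Set where
  constructor mod-intro
  field ∣-difference : + n Signed.∣ a - b
open _≡_mod_ public

module _ {n : ℕ} where

  ≡⇒≡-mod : {a b : ℤ} → a ≡ b → a ≡ b mod n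
  ≡⇒≡-mod {a} refl = mod-intro (Signed.divides 0ℤ (ℤ.+-inverseʳ a))

  ≡-mod-sym : {a b : ℤ} → a ≡ b mod n → b ≡ a mod n
  ≡-mod-sym {a} {b} (mod-intro n∣a-b) = mod-intro (subst (+ n Signed.∣_) (negate a b) (Signed.∣m⇒∣-m n∣a-b))
    where
    negate : ∀ a b → - (a - b) ≡ b - a
    negate = solve-∀

  ≡-mod-trans : {a b c : ℤ} → a ≡ b mod n → b ≡ c mod n → a ≡ c mod n
  ≡-mod-trans {a} {b} {c} (mod-intro n∣a-b) (mod-intro n∣b-c) =
    mod-intro (subst (+ n Signed.∣_) (telescope a b c) (Signed.∣m∣n⇒∣m+n n∣a-b n∣b-c))
    where
    telescope : ∀ a b c → (a - b) + (b - c) ≡ a - c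
    telescope = solve-∀

  ≡-mod-setoid : Setoid 0ℓ 0ℓ
  ≡-mod-setoid = record
    { Carrier = ℤ
    ; _≈_ = λ a b → a ≡ b mod n
    ; isEquivalence = record { refl = ≡⇒≡-mod refl ; sym = ≡-mod-sym ; trans = ≡-mod-trans }
    }

  module ≡-mod-Reasoning = Relation.Binary.Reasoning.Setoid ≡-mod-setoid

  +-cong-mod : {a b c d : ℤ} → a ≡ b mod n → c ≡ d mod n → a + c ≡ b + d mod n
  +-cong-mod {a} {b} {c} {d} (mod-intro n∣a-b) (mod-intro n∣c-d) =
    mod-intro (subst (+ n Signed.∣_) (interchange a b c d) (Signed.∣m∣n⇒∣m+n n∣a-b n∣c-d))
    where
    interchange : ∀ a b c d → (a - b) + (c - d) ≡ (a + c) - (b + d)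
    interchange = solve-∀

  *-cong-mod : {a b c d : ℤ} → a ≡ b mod n → c ≡ d mod n → a · c ≡ b · d mod n
  *-cong-mod {a} {b} {c} {d} (mod-intro n∣a-b) (mod-intro n∣c-d) =
    mod-intro (subst (+ n Signed.∣_) (split a b c d) (Signed.∣m∣n⇒∣m+n (Signed.∣m⇒∣m*n c n∣a-b) (Signed.∣n⇒∣m*n b n∣c-d)))
    where
    split : ∀ a b c d → (a - b) · c + b · (c - d) ≡ a · c - b · d
    split = solve-∀

  *-congˡ-mod : ∀ a {b c} → b ≡ c mod n → a · b ≡ a · c mod n
  *-congˡ-mod a = *-cong-mod (≡⇒≡-mod {a} refl)

  *-congʳ-mod : ∀ a {b c} → b ≡ c mod n → b · a ≡ c · a mod n
  *-congʳ-mod a b≡c = *-cong-mod b≡c (≡⇒≡-mod {a} refl)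

  ∑-cong-mod : (xs : List A) {f g : A → ℤ} → (∀ {x} → x ∈ xs → f x ≡ g x mod n) → ∑ xs f ≡ ∑ xs g mod n
  ∑-cong-mod [] eq = ≡⇒≡-mod refl
  ∑-cong-mod (x ∷ xs) eq = +-cong-mod (eq (here refl)) (∑-cong-mod xs (λ x∈xs → eq (there x∈xs)))

  ∑-𝟙-*-mod : {P : A → Set} (P? : ∀ x → Dec (P x)) (xs : List A) {f : A → ℤ} {c : ℤ} →
    (∀ {x} → x ∈ xs → P x → f x ≡ c mod n) → ∑[ x ∈ xs ] (𝟙 (P? x) · f x) ≡ c · ∑[ x ∈ xs ] 𝟙 (P? x) mod n
  ∑-𝟙-*-mod P? xs {f} {c} f≡c = ≡-mod-trans (∑-cong-mod xs term) (≡⇒≡-mod (sym (*-distribˡ-∑ c xs (λ x → 𝟙 (P? x)))))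
    where
    term : ∀ {x} → x ∈ xs → 𝟙 (P? x) · f x ≡ c · 𝟙 (P? x) mod n
    term {x} x∈xs with P? x
    ... | yes px = ≡-mod-trans (≡⇒≡-mod (ℤ.*-identityˡ (f x)))
                               (≡-mod-trans (f≡c x∈xs px) (≡⇒≡-mod (sym (ℤ.*-identityʳ c))))
    ... | no _ = ≡⇒≡-mod (trans (ℤ.*-zeroˡ (f x)) (sym (ℤ.*-zeroʳ c)))

  ∣⇒≡0-mod : {a : ℤ} → + n Signed.∣ a → a ≡ 0ℤ mod n
  ∣⇒≡0-mod {a} n∣a = mod-intro (subst (+ n Signed.∣_) (sym (ℤ.+-identityʳ a)) n∣a)

  ≡0-mod⇒∣ : {a : ℤ} → a ≡ 0ℤ mod n → + n Signed.∣ a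
  ≡0-mod⇒∣ {a} (mod-intro n∣a-0) = subst (+ n Signed.∣_) (ℤ.+-identityʳ a) n∣a-0

rootsOneTo : ℕ → ℤ → ℤ
rootsOneTo zero x = 1ℤ
rootsOneTo (suc k) x = (x - + suc k) · rootsOneTo k x

rootsOneTo-cong-mod : ∀ k {n} {x y} → x ≡ y mod n → rootsOneTo k x ≡ rootsOneTo k y mod n
rootsOneTo-cong-mod zero x≡y = ≡⇒≡-mod refl
rootsOneTo-cong-mod (suc k) x≡y = *-cong-mod (+-cong-mod x≡y (≡⇒≡-mod {a = - + suc k} refl)) (rootsOneTo-cong-mod k x≡y)

rootsOneTo-root : ∀ k {n r x} → 1 ≤ r → r ≤ k → x ≡ + r mod n → rootsOneTo k x ≡ 0ℤ mod n
rootsOneTo-root zero 1≤r r≤0 x≡r with () ← ℕ.≤-trans 1≤r r≤0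
rootsOneTo-root (suc k) {n} {r} {x} 1≤r r≤1+k x≡r with r ≟ suc k
... | yes refl = begin
  (x - + r) · rootsOneTo k x   ≈⟨ *-congʳ-mod (rootsOneTo k x) (∣⇒≡0-mod (∣-difference x≡r)) ⟩
  0ℤ · rootsOneTo k x          ≡⟨ ℤ.*-zeroˡ (rootsOneTo k x) ⟩
  0ℤ                           ∎
  where open ≡-mod-Reasoning
... | no r≢1+k = begin
  (x - + suc k) · rootsOneTo k x   ≈⟨ *-congˡ-mod (x - + suc k) (rootsOneTo-root k 1≤r r≤k x≡r) ⟩
  (x - + suc k) · 0ℤ               ≡⟨ ℤ.*-zeroʳ (x - + suc k) ⟩
  0ℤ                               ∎
  where
  open ≡-mod-Reasoning
  r≤k = ℕ.≤-pred (ℕ.≤∧≢⇒< r≤1+k r≢1+k)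

rootsOneTo-indicator : ∀ m x → rootsOneTo m x ≡ rootsOneTo m 0ℤ · 𝟙 (suc m ∣? ∣ x ∣) mod suc m
rootsOneTo-indicator m x with suc m ∣? ∣ x ∣
... | yes p∣x = begin
  rootsOneTo m x        ≈⟨ rootsOneTo-cong-mod m (∣⇒≡0-mod (Signed.∣ᵤ⇒∣ p∣x)) ⟩
  rootsOneTo m 0ℤ       ≡⟨ sym (ℤ.*-identityʳ (rootsOneTo m 0ℤ)) ⟩
  rootsOneTo m 0ℤ · 1ℤ  ∎
  where open ≡-mod-Reasoning
... | no p∤x = begin
  rootsOneTo m x        ≈⟨ rootsOneTo-root m 1≤r r≤m x≡r ⟩
  0ℤ                    ≡⟨ sym (ℤ.*-zeroʳ (rootsOneTo m 0ℤ)) ⟩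
  rootsOneTo m 0ℤ · 0ℤ  ∎
  where
  open ≡-mod-Reasoning
  r : ℕ
  r = x ℤ.%ℕ suc m
  x≡r : x ≡ + r mod suc m
  x≡r = mod-intro (Signed.divides (x ℤ./ℕ suc m) (trans (cong (_- + r) (ℤ.a≡a%ℕn+[a/ℕn]*n x (suc m))) (cancel (+ r) _)))
    where
    cancel : ∀ a b → a + b - a ≡ b
    cancel = solve-∀
  1≤r : 1 ≤ r
  1≤r with r ≟ 0
  ... | no r≢0 = ℕ.n≢0⇒n>0 r≢0
  ... | yes r≡0 = ⊥-elim (p∤x (Signed.∣⇒∣ᵤ (subst (+ suc m Signed.∣_) (trans (cong (λ t → x - + t) r≡0) (ℤ.+-identityʳ x))
                                                     (∣-difference x≡r))))
  r≤m : r ≤ m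
  r≤m = ℕ.≤-pred (ℤ.n%ℕd<d x (suc m))

module _ {p : ℕ} (isPrime : Prime p) where

  prime∤* : ∀ {a b} → ¬ p ℕ.∣ a → ¬ p ℕ.∣ b → ¬ p ℕ.∣ a ℕ.* b
  prime∤* p∤a p∤b p∣ab with euclidsLemma _ _ isPrime p∣ab
  ... | inj₁ p∣a = p∤a p∣a
  ... | inj₂ p∣b = p∤b p∣b

  prime∤rootsOneTo-0 : ∀ k → k < p → ¬ p ℕ.∣ ∣ rootsOneTo k 0ℤ ∣
  prime∤rootsOneTo-0 zero _ p∣1 = ℕ.<⇒≢ (ℕ.nonTrivial⇒n>1 p {{prime⇒nonTrivial isPrime}}) (sym (ℕ.∣1⇒≡1 p∣1))
  prime∤rootsOneTo-0 (suc k) k<p p∣Q =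
    prime∤* (λ p∣1+k → ℕ.<⇒≱ k<p (ℕ.∣⇒≤ p∣1+k)) (prime∤rootsOneTo-0 k (ℕ.<-trans (ℕ.n<1+n k) k<p))
      (subst (p ℕ.∣_) (ℤ.abs-* (0ℤ - + suc k) (rootsOneTo k 0ℤ)) p∣Q)

  *-cancelˡ-≡0-mod : ∀ a {x} → ¬ p ℕ.∣ ∣ a ∣ → a · x ≡ 0ℤ mod p → x ≡ 0ℤ mod p
  *-cancelˡ-≡0-mod a {x} p∤a ax≡0
    with euclidsLemma _ _ isPrime (subst (p ℕ.∣_) (ℤ.abs-* a x) (Signed.∣⇒∣ᵤ (≡0-mod⇒∣ ax≡0)))
  ... | inj₁ p∣a = ⊥-elim (p∤a p∣a)
  ... | inj₂ p∣x = ∣⇒≡0-mod (Signed.∣ᵤ⇒∣ p∣x)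

multiple-below-3* : ∀ {p n} → p ℕ.∣ n → n < 3 * p → n ≡ 0 ⊎ n ≡ p ⊎ n ≡ 2 * p
multiple-below-3* (ℕ.divides 0 refl) _ = inj₁ refl
multiple-below-3* {p} (ℕ.divides 1 refl) _ = inj₂ (inj₁ (ℕ.+-identityʳ p))
multiple-below-3* (ℕ.divides 2 refl) _ = inj₂ (inj₂ refl)
multiple-below-3* {p} (ℕ.divides (suc (suc (suc k))) refl) n<3p =
  ⊥-elim (ℕ.<⇒≱ n<3p (ℕ.*-monoˡ-≤ p {3} {suc (suc (suc k))} (s≤s (s≤s (s≤s z≤n)))))

module FiniteDifferences {M : Set} {_∙_ : M → M → M} {ε : M}
                         (isCommutativeMonoid : IsCommutativeMonoid _≡_ _∙_ ε) where

  open IsCommutativeMonoid isCommutativeMonoid using (assoc; comm; identityˡ)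

  ∙-swap : ∀ x y z → x ∙ (y ∙ z) ≡ y ∙ (x ∙ z)
  ∙-swap x y z = begin
    x ∙ (y ∙ z) ≡⟨ sym (assoc x y z) ⟩
    (x ∙ y) ∙ z ≡⟨ cong (_∙ z) (comm x y) ⟩
    (y ∙ x) ∙ z ≡⟨ assoc y x z ⟩
    y ∙ (x ∙ z) ∎
    where open ≡-Reasoning

  Δ : M → (M → ℤ) → M → ℤ
  Δ c f v = f (c ∙ v) - f v

  DegreeAtMost : ℕ → (M → ℤ) → Set
  DegreeAtMost zero f = ∀ v → f v ≡ f ε
  DegreeAtMost (suc d) f = ∀ c → DegreeAtMost d (Δ c f)

  DegreeAtMost-resp : ∀ d {f g : M → ℤ} → (∀ v → f v ≡ g v) → DegreeAtMost d f → DegreeAtMost d g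
  DegreeAtMost-resp zero f≗g deg v = trans (sym (f≗g v)) (trans (deg v) (f≗g ε))
  DegreeAtMost-resp (suc d) f≗g deg c = DegreeAtMost-resp d (λ v → cong₂ _-_ (f≗g (c ∙ v)) (f≗g v)) (deg c)

  DegreeAtMost-const : ∀ d k → DegreeAtMost d (λ _ → k)
  DegreeAtMost-const zero k v = refl
  DegreeAtMost-const (suc d) k c = DegreeAtMost-resp d (λ _ → sym (ℤ.+-inverseʳ k)) (DegreeAtMost-const d 0ℤ)

  DegreeAtMost-+ : ∀ d {f g : M → ℤ} → DegreeAtMost d f → DegreeAtMost d g → DegreeAtMost d (λ v → f v + g v)
  DegreeAtMost-+ zero degf degg v = cong₂ _+_ (degf v) (degg v)
  DegreeAtMost-+ (suc d) {f} {g} degf degg c =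
    DegreeAtMost-resp d (λ v → interchange (f (c ∙ v)) (f v) (g (c ∙ v)) (g v)) (DegreeAtMost-+ d (degf c) (degg c))
    where
    interchange : ∀ a b x y → (a - b) + (x - y) ≡ (a + x) - (b + y)
    interchange = solve-∀

  DegreeAtMost-*ˡ : ∀ d k {f : M → ℤ} → DegreeAtMost d f → DegreeAtMost d (λ v → k · f v)
  DegreeAtMost-*ˡ zero k degf v = cong (k ·_) (degf v)
  DegreeAtMost-*ˡ (suc d) k {f} degf c =
    DegreeAtMost-resp d (λ v → distrib k (f (c ∙ v)) (f v)) (DegreeAtMost-*ˡ d k (degf c))
    where
    distrib : ∀ k a b → k · (a - b) ≡ k · a - k · b
    distrib = solve-∀

  DegreeAtMost-translate : ∀ d c {f : M → ℤ} → DegreeAtMost d f → DegreeAtMost d (λ v → f (c ∙ v))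
  DegreeAtMost-translate zero c degf v = trans (degf (c ∙ v)) (sym (degf (c ∙ ε)))
  DegreeAtMost-translate (suc d) c {f} degf a =
    DegreeAtMost-resp d (λ v → cong (λ u → f u - f (c ∙ v)) (∙-swap a c v)) (DegreeAtMost-translate d c (degf a))

  DegreeAtMost-* : ∀ d e {f g : M → ℤ} → DegreeAtMost d f → DegreeAtMost e g → DegreeAtMost (d +ℕ e) (λ v → f v · g v)
  DegreeAtMost-* zero e {f} {g} degf degg =
    DegreeAtMost-resp e (λ v → cong (_· g v) (sym (degf v))) (DegreeAtMost-*ˡ e (f ε) degg)
  DegreeAtMost-* (suc d) zero {f} {g} degf degg =
    subst (λ n → DegreeAtMost n (λ v → f v · g v)) (sym (ℕ.+-identityʳ (suc d)))
      (DegreeAtMost-resp (suc d) (λ v → trans (ℤ.*-comm (g ε) (f v)) (cong (f v ·_) (sym (degg v))))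
        (DegreeAtMost-*ˡ (suc d) (g ε) degf))
  DegreeAtMost-* (suc d) (suc e) {f} {g} degf degg c =
    DegreeAtMost-resp (d +ℕ suc e) (λ v → leibniz (f (c ∙ v)) (f v) (g (c ∙ v)) (g v))
      (DegreeAtMost-+ (d +ℕ suc e)
        (DegreeAtMost-* d (suc e) {Δ c f} {λ v → g (c ∙ v)} (degf c) (DegreeAtMost-translate (suc e) c {g} degg))
        (subst (λ n → DegreeAtMost n (λ v → f v · Δ c g v)) (sym (ℕ.+-suc d e))
          (DegreeAtMost-* (suc d) e {f} {Δ c g} degf (degg c))))
    where
    leibniz : ∀ a b x y → (a - b) · x + b · (x - y) ≡ a · x - b · y
    leibniz = solve-∀

  DegreeAtMost-additive : {L : M → ℤ} → (∀ u v → L (u ∙ v) ≡ L u + L v) → DegreeAtMost 1 L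
  DegreeAtMost-additive {L} additive c v = begin
    L (c ∙ v) - L v   ≡⟨ cong (_- L v) (additive c v) ⟩
    L c + L v - L v   ≡⟨ cancel (L c) (L v) ⟩
    L c               ≡⟨ sym (cancel (L c) (L ε)) ⟩
    L c + L ε - L ε   ≡⟨ cong (_- L ε) (sym (additive c ε)) ⟩
    L (c ∙ ε) - L ε   ∎
    where
    open ≡-Reasoning
    cancel : ∀ a b → a + b - b ≡ a
    cancel = solve-∀

  DegreeAtMost-rootsOneTo : ∀ k {L : M → ℤ} → (∀ u v → L (u ∙ v) ≡ L u + L v) →
    DegreeAtMost k (λ v → rootsOneTo k (L v))
  DegreeAtMost-rootsOneTo zero additive = DegreeAtMost-const zero 1ℤ
  DegreeAtMost-rootsOneTo (suc k) {L} additive =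
    DegreeAtMost-* 1 k {λ v → L v - + suc k}
                       (DegreeAtMost-+ 1 {L} (DegreeAtMost-additive {L} additive) (DegreeAtMost-const 1 (- + suc k)))
                       (DegreeAtMost-rootsOneTo k additive)

  weight : (A → M) → List A → M
  weight w [] = ε
  weight w (x ∷ xs) = w x ∙ weight w xs

  weight-Interleaving : (w : A → M) {xs ys zs : List A} → Interleaving ys zs xs →
    weight w xs ≡ weight w ys ∙ weight w zs
  weight-Interleaving w [] = sym (identityˡ ε)
  weight-Interleaving w (_∷ˡ_ {c = x} refl sp) = trans (cong (w x ∙_) (weight-Interleaving w sp)) (sym (assoc _ _ _))
  weight-Interleaving w (_∷ʳ_ {c = x} refl sp) = trans (cong (w x ∙_) (weight-Interleaving w sp)) (∙-swap _ _ _)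

  alternatingSum : (A → M) → List A → (M → ℤ) → ℤ
  alternatingSum w xs f = ∑[ ys ∈ sublists xs ] (-1ℤ ^ length ys · f (weight w ys))

  alternatingSum-*ˡ : (w : A → M) (xs : List A) (c : ℤ) (f : M → ℤ) →
    alternatingSum w xs (λ v → c · f v) ≡ c · alternatingSum w xs f
  alternatingSum-*ˡ w xs c f = trans (∑-cong (sublists xs) (λ {ys} _ → commute (-1ℤ ^ length ys) c _))
                                     (sym (*-distribˡ-∑ c (sublists xs) _))
    where
    commute : ∀ s c x → s · (c · x) ≡ c · (s · x)
    commute = solve-∀

  alternatingSum-cong-mod : (w : A → M) (xs : List A) {n : ℕ} {f g : M → ℤ} →
    (∀ v → f v ≡ g v mod n) → alternatingSum w xs f ≡ alternatingSum w xs g mod n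
  alternatingSum-cong-mod w xs f≡g = ∑-cong-mod (sublists xs) (λ {ys} _ → *-congˡ-mod (-1ℤ ^ length ys) (f≡g (weight w ys)))

  alternatingSum-∷ : (w : A → M) (x : A) (xs : List A) (f : M → ℤ) →
    alternatingSum w (x ∷ xs) f ≡ - alternatingSum w xs (Δ (w x) f)
  alternatingSum-∷ w x xs f = begin
    alternatingSum w (x ∷ xs) f
      ≡⟨ ∑-++ (sublists xs) (map (x ∷_) (sublists xs)) _ ⟩
    alternatingSum w xs f + ∑ (map (x ∷_) (sublists xs)) term
      ≡⟨ cong (_+_ (alternatingSum w xs f)) (∑-map (x ∷_) (sublists xs) term) ⟩
    alternatingSum w xs f + ∑[ ys ∈ sublists xs ] (-1ℤ · -1ℤ ^ length ys · f (w x ∙ weight w ys))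
      ≡⟨ sym (∑-distrib-+ (sublists xs) _ _) ⟩
    ∑[ ys ∈ sublists xs ] (-1ℤ ^ length ys · f (weight w ys) + -1ℤ · -1ℤ ^ length ys · f (w x ∙ weight w ys))
      ≡⟨ ∑-cong (sublists xs) (λ {ys} _ → flip (-1ℤ ^ length ys) (f (weight w ys)) (f (w x ∙ weight w ys))) ⟩
    ∑[ ys ∈ sublists xs ] (-1ℤ · (-1ℤ ^ length ys · Δ (w x) f (weight w ys)))
      ≡⟨ sym (*-distribˡ-∑ -1ℤ (sublists xs) _) ⟩
    -1ℤ · alternatingSum w xs (Δ (w x) f)
      ≡⟨ ℤ.-1*i≡-i _ ⟩
    - alternatingSum w xs (Δ (w x) f) ∎
    where
    open ≡-Reasoning
    term : List _ → ℤ
    term ys = -1ℤ ^ length ys · f (weight w ys)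
    flip : ∀ s a b → s · a + -1ℤ · s · b ≡ -1ℤ · (s · (b - a))
    flip = solve-∀

  alternatingSum≡0 : (w : A → M) (xs : List A) {d : ℕ} {f : M → ℤ} →
    DegreeAtMost d f → d < length xs → alternatingSum w xs f ≡ 0ℤ
  alternatingSum≡0 w (x ∷ xs) {zero} {f} degf _ = begin
    alternatingSum w (x ∷ xs) f                ≡⟨ alternatingSum-∷ w x xs f ⟩
    - alternatingSum w xs (Δ (w x) f)          ≡⟨ cong -_ (∑-cong (sublists xs) (λ {ys} _ → vanish ys)) ⟩
    - ∑[ ys ∈ sublists xs ] 0ℤ                  ≡⟨ cong -_ (∑-zero (sublists xs)) ⟩
    0ℤ                                          ∎
    where
    open ≡-Reasoning
    vanish : ∀ ys → -1ℤ ^ length ys · Δ (w x) f (weight w ys) ≡ 0ℤ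
    vanish ys = trans (cong (λ t → -1ℤ ^ length ys · (t - f (weight w ys))) (trans (degf _) (sym (degf _))))
                      (trans (cong (-1ℤ ^ length ys ·_) (ℤ.+-inverseʳ (f (weight w ys)))) (ℤ.*-zeroʳ (-1ℤ ^ length ys)))
  alternatingSum≡0 w (x ∷ xs) {suc d} {f} degf (s≤s d<n) =
    trans (alternatingSum-∷ w x xs f) (cong -_ (alternatingSum≡0 w xs (degf (w x)) d<n))

_⊞_ : Point → Point → Point
(a , b) ⊞ (c , d) = (a + c , b + d)

module _ {n : ℕ} where

  private
    ∣-+ : ∀ x y → + n ∣ x → + n ∣ y → + n ∣ x + y
    ∣-+ x y n∣x n∣y = Signed.∣⇒∣ᵤ (Signed.∣m∣n⇒∣m+n (Signed.∣ᵤ⇒∣ {+ n} {x} n∣x) (Signed.∣ᵤ⇒∣ {+ n} {y} n∣y))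

    ∣-+⁻ : ∀ x y → + n ∣ x + y → + n ∣ y → + n ∣ x
    ∣-+⁻ x y n∣x+y n∣y =
      Signed.∣⇒∣ᵤ (Signed.∣m+n∣n⇒∣m {m = x} (Signed.∣ᵤ⇒∣ {+ n} {x + y} n∣x+y) (Signed.∣ᵤ⇒∣ {+ n} {y} n∣y))

  sumDivBy-⊞ : ∀ u v → sumDivBy n u → sumDivBy n v → sumDivBy n (u ⊞ v)
  sumDivBy-⊞ (a , b) (c , d) (n∣a , n∣b) (n∣c , n∣d) = (∣-+ a c n∣a n∣c , ∣-+ b d n∣b n∣d)

  sumDivBy-⊞⁻ : ∀ u v → sumDivBy n (u ⊞ v) → sumDivBy n v → sumDivBy n u
  sumDivBy-⊞⁻ (a , b) (c , d) (n∣a+c , n∣b+d) (n∣c , n∣d) = (∣-+⁻ a c n∣a+c n∣c , ∣-+⁻ b d n∣b+d n∣d)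

Tally : Set
Tally = ℤ × Point

_⊕_ : Tally → Tally → Tally
(k , u) ⊕ (l , v) = (k + l , u ⊞ v)

⊕-isCommutativeMonoid : IsCommutativeMonoid _≡_ _⊕_ (0ℤ , (0ℤ , 0ℤ))
⊕-isCommutativeMonoid = record
  { isMonoid = record
    { isSemigroup = record
      { isMagma = record { isEquivalence = Eq.isEquivalence ; ∙-cong = cong₂ _⊕_ }
      ; assoc = λ (k , (a , b)) (l , (c , d)) (n , (e , f)) →
          cong₂ _,_ (ℤ.+-assoc k l n) (cong₂ _,_ (ℤ.+-assoc a c e) (ℤ.+-assoc b d f))
      }
    ; identity = (λ (k , (a , b)) → cong₂ _,_ (ℤ.+-identityˡ k) (cong₂ _,_ (ℤ.+-identityˡ a) (ℤ.+-identityˡ b)))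
               , (λ (k , (a , b)) → cong₂ _,_ (ℤ.+-identityʳ k) (cong₂ _,_ (ℤ.+-identityʳ a) (ℤ.+-identityʳ b)))
    }
  ; comm = λ (k , (a , b)) (l , (c , d)) → cong₂ _,_ (ℤ.+-comm k l) (cong₂ _,_ (ℤ.+-comm a c) (ℤ.+-comm b d))
  }

open FiniteDifferences ⊕-isCommutativeMonoid

tally : Point → Tally
tally y = (1ℤ , y)

weight-tally : (xs : List Point) → weight tally xs ≡ (+ length xs , sumPts xs)
weight-tally [] = refl
weight-tally (x ∷ xs) = cong (tally x ⊕_) (weight-tally xs)

tally-Interleaving : ∀ {us vs uvs} → Interleaving us vs uvs →
  length uvs ≡ length us +ℕ length vs × sumPts uvs ≡ sumPts us ⊞ sumPts vs
tally-Interleaving {us} {vs} {uvs} sp = (ℤ.+-injective (cong proj₁ tallies) , cong proj₂ tallies)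
  where
  tallies : (+ length uvs , sumPts uvs) ≡ (+ length us , sumPts us) ⊕ (+ length vs , sumPts vs)
  tallies = trans (sym (weight-tally uvs)) (trans (weight-Interleaving tally sp) (cong₂ _⊕_ (weight-tally us) (weight-tally vs)))

-- The prime is written m + 1 so that p ∸ 1 and 3 * p ∸ 1 reduce definitionally.
module ZeroSums (m : ℕ) (isPrime : Prime (suc m)) where

  p : ℕ
  p = suc m

  ZeroSum : ℕ → List Point → Set
  ZeroSum k zs = length zs ≡ k × sumDivBy p (sumPts zs)

  zeroSum? : (k : ℕ) (zs : List Point) → Dec (ZeroSum k zs)
  zeroSum? k zs = (length zs ≟ k) ×-dec sumDivBy? p (sumPts zs)

  zeroSums : ℕ → List Point → ℤ
  zeroSums k xs = ∑[ zs ∈ sublists xs ] 𝟙 (zeroSum? k zs)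

  count≡zeroSums : ∀ k xs → + count p k xs ≡ zeroSums k xs
  count≡zeroSums k xs = length-filter-∑ (zeroSum? k) (sublists xs)

  ZeroSumFree : List Point → Set
  ZeroSumFree xs = ∀ {zs} → zs ⊆ xs → ¬ ZeroSum p zs

  count≡0⇒ZeroSumFree : ∀ {xs} → count p p xs ≡ 0 → ZeroSumFree xs
  count≡0⇒ZeroSumFree {xs} count≡0 zs⊆xs zero-sum = ℕ.<⇒≢ (filter-some (zeroSum? p) witness) (sym count≡0)
    where
    witness = Any.map (λ { refl → zero-sum }) (⊆⇒∈-sublists zs⊆xs)

  ZeroSumFree-⊆ : ∀ {xs ys} → ys ⊆ xs → ZeroSumFree xs → ZeroSumFree ys
  ZeroSumFree-⊆ ys⊆xs free zs⊆ys = free (⊆-trans zs⊆ys ys⊆xs)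

  q : ℤ
  q = rootsOneTo m 0ℤ

  divisiblePoly : Tally → ℤ
  divisiblePoly (k , (a , b)) = rootsOneTo m k · (rootsOneTo m a · rootsOneTo m b)

  divisiblePoly-degree : DegreeAtMost (3 * m) divisiblePoly
  divisiblePoly-degree = subst (λ d → DegreeAtMost d divisiblePoly) (sym (three-times m))
    (DegreeAtMost-* m (m +ℕ m) (DegreeAtMost-rootsOneTo m {proj₁} (λ _ _ → refl))
      (DegreeAtMost-* m m (DegreeAtMost-rootsOneTo m {λ (_ , (a , _)) → a} (λ _ _ → refl))
                          (DegreeAtMost-rootsOneTo m {λ (_ , (_ , b)) → b} (λ _ _ → refl))))
    where
    three-times : ∀ m → 3 * m ≡ m +ℕ (m +ℕ m)
    three-times = ℕ-Solver.solve-∀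

  divisible : Tally → ℤ
  divisible (k , u) = 𝟙 (p ∣? ∣ k ∣) · 𝟙 (sumDivBy? p u)

  divisiblePoly≡divisible : ∀ v → divisiblePoly v ≡ q · (q · q) · divisible v mod p
  divisiblePoly≡divisible (k , (a , b)) = begin
    rootsOneTo m k · (rootsOneTo m a · rootsOneTo m b)
      ≈⟨ *-cong-mod (rootsOneTo-indicator m k) (*-cong-mod (rootsOneTo-indicator m a) (rootsOneTo-indicator m b)) ⟩
    q · 𝟙 k? · (q · 𝟙 a? · (q · 𝟙 b?))
      ≡⟨ regroup q (𝟙 k?) (𝟙 a?) (𝟙 b?) ⟩
    q · (q · q) · (𝟙 k? · (𝟙 a? · 𝟙 b?))
      ≡⟨ cong (λ t → q · (q · q) · (𝟙 k? · t)) (sym (𝟙-×-dec a? b?)) ⟩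
    q · (q · q) · (𝟙 k? · 𝟙 (a? ×-dec b?)) ∎
    where
    open ≡-mod-Reasoning
    k? = p ∣? ∣ k ∣
    a? = p ∣? ∣ a ∣
    b? = p ∣? ∣ b ∣
    regroup : ∀ q x y z → q · x · (q · y · (q · z)) ≡ q · (q · q) · (x · (y · z))
    regroup = solve-∀

  signed-indicator : ∀ n (z : ℤ) → n < 3 * p → (n ≡ p → z ≡ 0ℤ) →
    -1ℤ ^ n · (𝟙 (p ∣? n) · z) ≡ 𝟙 (n ≟ 0) · z + 𝟙 (n ≟ 2 * p) · z
  signed-indicator n z n<3p n≡p⇒z≡0 with p ∣? n
  ... | no p∤n = trans (vanish (-1ℤ ^ n) z)
          (cong₂ (λ a b → a · z + b · z) (sym (𝟙-no (n ≟ 0) (λ { refl → p∤n (p ℕ.∣0) })))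
                                          (sym (𝟙-no (n ≟ 2 * p) (λ { refl → p∤n (ℕ.n∣m*n 2) }))))
    where
    vanish : ∀ s z → s · (0ℤ · z) ≡ 0ℤ · z + 0ℤ · z
    vanish = solve-∀
  ... | yes p∣n with multiple-below-3* p∣n n<3p
  ...   | inj₁ refl = unit z
    where
    unit : ∀ z → 1ℤ · (1ℤ · z) ≡ 1ℤ · z + 0ℤ · z
    unit = solve-∀
  ...   | inj₂ (inj₁ refl) rewrite n≡p⇒z≡0 refl = vanish (-1ℤ ^ p) (𝟙 (p ≟ 0)) (𝟙 (p ≟ 2 * p))
    where
    vanish : ∀ s a b → s · (1ℤ · 0ℤ) ≡ a · 0ℤ + b · 0ℤ
    vanish = solve-∀
  ...   | inj₂ (inj₂ refl) = begin
    -1ℤ ^ (2 * p) · (1ℤ · z)   ≡⟨ cong (_· (1ℤ · z)) even-power ⟩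
    1ℤ · (1ℤ · z)              ≡⟨ unit z ⟩
    0ℤ · z + 1ℤ · z             ≡⟨ cong (λ t → 0ℤ · z + t · z) (sym (𝟙-yes (2 * p ≟ 2 * p) refl)) ⟩
    0ℤ · z + 𝟙 (2 * p ≟ 2 * p) · z ∎
    where
    open ≡-Reasoning
    even-power : -1ℤ ^ (2 * p) ≡ 1ℤ
    even-power = trans (sym (ℤ.^-*-assoc -1ℤ 2 p)) (ℤ.^-zeroˡ p)
    unit : ∀ z → 1ℤ · (1ℤ · z) ≡ 0ℤ · z + 1ℤ · z
    unit = solve-∀

  zeroSums-0 : ∀ xs → zeroSums 0 xs ≡ 1ℤ
  zeroSums-0 [] = cong (_+ 0ℤ) (𝟙-yes (zeroSum? 0 []) (refl , (p ℕ.∣0 , p ℕ.∣0)))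
  zeroSums-0 (x ∷ xs) = begin
    ∑ (sublists xs ++ map (x ∷_) (sublists xs)) (λ zs → 𝟙 (zeroSum? 0 zs))
      ≡⟨ ∑-++ (sublists xs) _ _ ⟩
    zeroSums 0 xs + ∑ (map (x ∷_) (sublists xs)) (λ zs → 𝟙 (zeroSum? 0 zs))
      ≡⟨ cong₂ _+_ (zeroSums-0 xs) (∑-map (x ∷_) (sublists xs) _) ⟩
    1ℤ + ∑[ zs ∈ sublists xs ] 𝟙 (zeroSum? 0 (x ∷ zs))
      ≡⟨ cong (_+_ 1ℤ) (trans (∑-cong (sublists xs) (λ {zs} _ → 𝟙-no (zeroSum? 0 (x ∷ zs)) (λ { (() , _) })))
                              (∑-zero (sublists xs))) ⟩
    1ℤ + 0ℤ ∎
    where open ≡-Reasoning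

  alternatingSum-divisible : ∀ {xs} → ZeroSumFree xs → length xs < 3 * p →
    alternatingSum tally xs divisible ≡ 1ℤ + zeroSums (2 * p) xs
  alternatingSum-divisible {xs} free len<3p = begin
    alternatingSum tally xs divisible
      ≡⟨ ∑-cong (sublists xs) (λ {zs} zs∈ → trans (cong (λ v → -1ℤ ^ length zs · divisible v) (weight-tally zs))
                                                 (term zs (∈-sublists⇒⊆ zs∈))) ⟩
    ∑[ zs ∈ sublists xs ] (𝟙 (zeroSum? 0 zs) + 𝟙 (zeroSum? (2 * p) zs))
      ≡⟨ ∑-distrib-+ (sublists xs) _ _ ⟩
    zeroSums 0 xs + zeroSums (2 * p) xs
      ≡⟨ cong (_+ zeroSums (2 * p) xs) (zeroSums-0 xs) ⟩
    1ℤ + zeroSums (2 * p) xs ∎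
    where
    open ≡-Reasoning
    term : ∀ zs → zs ⊆ xs →
      -1ℤ ^ length zs · (𝟙 (p ∣? length zs) · 𝟙 (sumDivBy? p (sumPts zs))) ≡ 𝟙 (zeroSum? 0 zs) + 𝟙 (zeroSum? (2 * p) zs)
    term zs zs⊆xs = begin
      -1ℤ ^ length zs · (𝟙 (p ∣? length zs) · z)
        ≡⟨ signed-indicator (length zs) z (ℕ.≤-<-trans (length-mono-≤ zs⊆xs) len<3p)
                            (λ len≡p → 𝟙-no (sumDivBy? p (sumPts zs)) (λ p∣sum → free zs⊆xs (len≡p , p∣sum))) ⟩
      𝟙 (length zs ≟ 0) · z + 𝟙 (length zs ≟ 2 * p) · z
        ≡⟨ sym (cong₂ _+_ (𝟙-×-dec (length zs ≟ 0) z?) (𝟙-×-dec (length zs ≟ 2 * p) z?)) ⟩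
      𝟙 (zeroSum? 0 zs) + 𝟙 (zeroSum? (2 * p) zs) ∎
      where
      z? = sumDivBy? p (sumPts zs)
      z = 𝟙 z?

  zeroSums-2p≡-1 : ∀ {xs} → ZeroSumFree xs → 3 * m < length xs → length xs < 3 * p →
    zeroSums (2 * p) xs ≡ -1ℤ mod p
  zeroSums-2p≡-1 {xs} free 3m<len len<3p = begin
    T                      ≡⟨ shift T ⟩
    (1ℤ + T) - 1ℤ          ≈⟨ +-cong-mod (*-cancelˡ-≡0-mod isPrime (q · (q · q)) q³∤ q³[1+T]≡0) (≡⇒≡-mod {a = - 1ℤ} refl) ⟩
    0ℤ - 1ℤ                ≡⟨⟩
    -1ℤ                    ∎
    where
    open ≡-mod-Reasoning
    T = zeroSums (2 * p) xs
    shift : ∀ t → t ≡ (1ℤ + t) - 1ℤ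
    shift = solve-∀
    q∤ : ¬ p ℕ.∣ ∣ q ∣
    q∤ = prime∤rootsOneTo-0 isPrime m (ℕ.n<1+n m)
    q³∤ : ¬ p ℕ.∣ ∣ q · (q · q) ∣
    q³∤ p∣q³ = prime∤* isPrime q∤ (λ p∣q² → prime∤* isPrime q∤ q∤ (subst (p ℕ.∣_) (ℤ.abs-* q q) p∣q²))
                                  (subst (p ℕ.∣_) (ℤ.abs-* q (q · q)) p∣q³)
    q³[1+T]≡0 : q · (q · q) · (1ℤ + T) ≡ 0ℤ mod p
    q³[1+T]≡0 = begin
      q · (q · q) · (1ℤ + T)
        ≡⟨ cong (q · (q · q) ·_) (sym (alternatingSum-divisible free len<3p)) ⟩
      q · (q · q) · alternatingSum tally xs divisible
        ≡⟨ sym (alternatingSum-*ˡ tally xs (q · (q · q)) divisible) ⟩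
      alternatingSum tally xs (λ v → q · (q · q) · divisible v)
        ≈⟨ alternatingSum-cong-mod tally xs (λ v → ≡-mod-sym (divisiblePoly≡divisible v)) ⟩
      alternatingSum tally xs divisiblePoly
        ≡⟨ alternatingSum≡0 tally xs divisiblePoly-degree 3m<len ⟩
      0ℤ ∎

  disjointPairs : List Point → ℤ
  disjointPairs xs = ∑ (splits xs) (λ (us , vws) → ∑ (splits vws) (λ (vs , _) → 𝟙 (zeroSum? m us) · 𝟙 (zeroSum? (2 * p) vs)))

  4p∸3≡ : 4 * p ∸ 3 ≡ m +ℕ suc (3 * m)
  4p∸3≡ = trans (cong (_∸ 3) (expand m)) (ℕ.m+n∸m≡n 3 (m +ℕ suc (3 * m)))
    where
    expand : ∀ m → 4 * suc m ≡ 3 +ℕ (m +ℕ suc (3 * m))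
    expand = ℕ-Solver.solve-∀

  3p≡ : 3 * p ≡ 3 +ℕ 3 * m
  3p≡ = expand m
    where
    expand : ∀ m → 3 * suc m ≡ 3 +ℕ 3 * m
    expand = ℕ-Solver.solve-∀

  3p∸1≡ : 3 * p ∸ 1 ≡ 2 +ℕ 3 * m
  3p∸1≡ = expand m
    where
    expand : ∀ m → m +ℕ 2 * suc m ≡ 2 +ℕ 3 * m
    expand = ℕ-Solver.solve-∀

  disjointPairs-by-first : ∀ {xs} → length xs ≡ 4 * p ∸ 3 → ZeroSumFree xs →
    disjointPairs xs ≡ -1ℤ · zeroSums m xs mod p
  disjointPairs-by-first {xs} len-xs free = begin
    disjointPairs xs
      ≡⟨ ∑-cong (splits xs) (λ {(us , vws)} _ → factor us vws) ⟩
    ∑ (splits xs) (λ (us , vws) → 𝟙 (zeroSum? m us) · zeroSums (2 * p) vws)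
      ≈⟨ ∑-𝟙-*-mod (λ (us , _) → zeroSum? m us) (splits xs) rest≡-1 ⟩
    -1ℤ · ∑ (splits xs) (λ (us , _) → 𝟙 (zeroSum? m us))
      ≡⟨ cong (-1ℤ ·_) (∑-splits-proj₁ xs (λ us → 𝟙 (zeroSum? m us))) ⟩
    -1ℤ · zeroSums m xs ∎
    where
    open ≡-mod-Reasoning
    factor : ∀ us vws → ∑ (splits vws) (λ (vs , _) → 𝟙 (zeroSum? m us) · 𝟙 (zeroSum? (2 * p) vs))
                      ≡ 𝟙 (zeroSum? m us) · zeroSums (2 * p) vws
    factor us vws = trans (sym (*-distribˡ-∑ (𝟙 (zeroSum? m us)) (splits vws) _))
                          (cong (𝟙 (zeroSum? m us) ·_) (∑-splits-proj₁ vws (λ vs → 𝟙 (zeroSum? (2 * p) vs))))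
    rest≡-1 : ∀ {split} → split ∈ splits xs → ZeroSum m (proj₁ split) → zeroSums (2 * p) (proj₂ split) ≡ -1ℤ mod p
    rest≡-1 {us , vws} mem (len-us , _) =
      zeroSums-2p≡-1 (ZeroSumFree-⊆ (Interleaving⇒⊆ˡ (Interleaving.swap sp)) free)
                     (subst (3 * m <_) (sym len-vws) (ℕ.n<1+n _))
                     (subst₂ _<_ (sym len-vws) (sym 3p≡) (s≤s (ℕ.n≤1+n _)))
      where
      sp = ∈-splits⇒Interleaving mem
      len-vws : length vws ≡ suc (3 * m)
      len-vws = ℕ.+-cancelˡ-≡ m (length vws) _
                  (trans (cong (_+ℕ length vws) (sym len-us)) (trans (sym (proj₁ (tally-Interleaving sp))) (trans len-xs 4p∸3≡)))

  zeroSum-complement : ∀ {us vs uvs} → Interleaving us vs uvs → ZeroSum (2 * p) vs →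
    (ZeroSum m us → ZeroSum (3 * p ∸ 1) uvs) × (ZeroSum (3 * p ∸ 1) uvs → ZeroSum m us)
  zeroSum-complement {us} {vs} {uvs} sp (len-vs , p∣vs) = to , from
    where
    lengths = proj₁ (tally-Interleaving sp)
    sums = proj₂ (tally-Interleaving sp)
    to : ZeroSum m us → ZeroSum (3 * p ∸ 1) uvs
    to (len-us , p∣us) = trans lengths (cong₂ _+ℕ_ len-us len-vs)
                       , subst (sumDivBy p) (sym sums) (sumDivBy-⊞ (sumPts us) (sumPts vs) p∣us p∣vs)
    from : ZeroSum (3 * p ∸ 1) uvs → ZeroSum m us
    from (len-uvs , p∣uvs) =
        ℕ.+-cancelʳ-≡ (length vs) (length us) m (trans (sym lengths) (trans len-uvs (cong (m +ℕ_) (sym len-vs))))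
      , sumDivBy-⊞⁻ (sumPts us) (sumPts vs) (subst (sumDivBy p) sums p∣uvs) p∣vs

  zeroSumPairs-within : ∀ uvs → ∑ (splits uvs) (λ (us , vs) → 𝟙 (zeroSum? m us) · 𝟙 (zeroSum? (2 * p) vs))
                             ≡ 𝟙 (zeroSum? (3 * p ∸ 1) uvs) · zeroSums (2 * p) uvs
  zeroSumPairs-within uvs = begin
    ∑ (splits uvs) (λ (us , vs) → 𝟙 (zeroSum? m us) · 𝟙 (zeroSum? (2 * p) vs))
      ≡⟨ ∑-cong (splits uvs) (λ mem → complement (∈-splits⇒Interleaving mem)) ⟩
    ∑ (splits uvs) (λ (_ , vs) → 𝟙 (zeroSum? (3 * p ∸ 1) uvs) · 𝟙 (zeroSum? (2 * p) vs))
      ≡⟨ sym (*-distribˡ-∑ (𝟙 (zeroSum? (3 * p ∸ 1) uvs)) (splits uvs) (λ (_ , vs) → 𝟙 (zeroSum? (2 * p) vs))) ⟩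
    𝟙 (zeroSum? (3 * p ∸ 1) uvs) · ∑ (splits uvs) (λ (_ , vs) → 𝟙 (zeroSum? (2 * p) vs))
      ≡⟨ cong (𝟙 (zeroSum? (3 * p ∸ 1) uvs) ·_)
              (trans (∑-splits-swap uvs (λ _ vs → 𝟙 (zeroSum? (2 * p) vs))) (∑-splits-proj₁ uvs _)) ⟩
    𝟙 (zeroSum? (3 * p ∸ 1) uvs) · zeroSums (2 * p) uvs ∎
    where
    open ≡-Reasoning
    complement : ∀ {us vs} → Interleaving us vs uvs →
      𝟙 (zeroSum? m us) · 𝟙 (zeroSum? (2 * p) vs) ≡ 𝟙 (zeroSum? (3 * p ∸ 1) uvs) · 𝟙 (zeroSum? (2 * p) vs)
    complement {us} {vs} sp with zeroSum? (2 * p) vs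
    ... | yes zero-sum = let (to , from) = zeroSum-complement sp zero-sum in
                         cong (_· 1ℤ) (𝟙-cong (zeroSum? m us) (zeroSum? (3 * p ∸ 1) uvs) to from)
    ... | no _ = trans (ℤ.*-zeroʳ (𝟙 (zeroSum? m us))) (sym (ℤ.*-zeroʳ (𝟙 (zeroSum? (3 * p ∸ 1) uvs))))

  disjointPairs-by-union : ∀ {xs} → ZeroSumFree xs → disjointPairs xs ≡ -1ℤ · zeroSums (3 * p ∸ 1) xs mod p
  disjointPairs-by-union {xs} free = begin
    disjointPairs xs
      ≡⟨ ∑-splits-assoc xs (λ us vs _ → 𝟙 (zeroSum? m us) · 𝟙 (zeroSum? (2 * p) vs)) ⟩
    ∑ (splits xs) (λ (uvs , _) → ∑ (splits uvs) (λ (us , vs) → 𝟙 (zeroSum? m us) · 𝟙 (zeroSum? (2 * p) vs)))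
      ≡⟨ ∑-cong (splits xs) (λ {(uvs , _)} _ → zeroSumPairs-within uvs) ⟩
    ∑ (splits xs) (λ (uvs , _) → 𝟙 (zeroSum? (3 * p ∸ 1) uvs) · zeroSums (2 * p) uvs)
      ≈⟨ ∑-𝟙-*-mod (λ (uvs , _) → zeroSum? (3 * p ∸ 1) uvs) (splits xs) rest≡-1 ⟩
    -1ℤ · ∑ (splits xs) (λ (uvs , _) → 𝟙 (zeroSum? (3 * p ∸ 1) uvs))
      ≡⟨ cong (-1ℤ ·_) (∑-splits-proj₁ xs (λ uvs → 𝟙 (zeroSum? (3 * p ∸ 1) uvs))) ⟩
    -1ℤ · zeroSums (3 * p ∸ 1) xs ∎
    where
    open ≡-mod-Reasoning
    rest≡-1 : ∀ {split} → split ∈ splits xs → ZeroSum (3 * p ∸ 1) (proj₁ split) → zeroSums (2 * p) (proj₁ split) ≡ -1ℤ mod p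
    rest≡-1 {uvs , _} mem (len-uvs , _) =
      zeroSums-2p≡-1 (ZeroSumFree-⊆ (Interleaving⇒⊆ˡ (∈-splits⇒Interleaving mem)) free)
                     (subst (3 * m <_) (sym (trans len-uvs 3p∸1≡)) (ℕ.≤-trans (ℕ.n<1+n _) (ℕ.n≤1+n _)))
                     (subst₂ _<_ (sym (trans len-uvs 3p∸1≡)) (sym 3p≡) ℕ.≤-refl)

  zeroSums-p∸1≡zeroSums-3p∸1 : ∀ {xs} → length xs ≡ 4 * p ∸ 3 → ZeroSumFree xs →
    zeroSums m xs ≡ zeroSums (3 * p ∸ 1) xs mod p
  zeroSums-p∸1≡zeroSums-3p∸1 {xs} len-xs free = begin
    zeroSums m xs                             ≡⟨ sym (negate-twice (zeroSums m xs)) ⟩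
    -1ℤ · (-1ℤ · zeroSums m xs)               ≈⟨ *-congˡ-mod -1ℤ (≡-mod-sym (disjointPairs-by-first len-xs free)) ⟩
    -1ℤ · disjointPairs xs                    ≈⟨ *-congˡ-mod -1ℤ (disjointPairs-by-union free) ⟩
    -1ℤ · (-1ℤ · zeroSums (3 * p ∸ 1) xs)    ≡⟨ negate-twice (zeroSums (3 * p ∸ 1) xs) ⟩
    zeroSums (3 * p ∸ 1) xs                  ∎
    where
    open ≡-mod-Reasoning
    negate-twice : ∀ x → -1ℤ · (-1ℤ · x) ≡ x
    negate-twice = solve-∀

mainTheorem6 : (p : ℕ) → Prime p → p ≢ 2 → (X : List Point) → Unique X →
    length X ≡ 4 * p ∸ 3 → count p p X ≡ 0 →
    (+ p) ∣ (+ count p (p ∸ 1) X - + count p (3 * p ∸ 1) X)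
mainTheorem6 zero isPrime = ⊥-elim (ℕ.≢-nonZero⁻¹ 0 {{prime⇒nonZero isPrime}} refl)
mainTheorem6 (suc m) isPrime _ X _ length-X count≡0 = Signed.∣⇒∣ᵤ (∣-difference counts-congruent)
  where
  open ZeroSums m isPrime
  counts-congruent : + count p m X ≡ + count p (3 * p ∸ 1) X mod p
  counts-congruent = subst₂ (λ a b → a ≡ b mod p) (sym (count≡zeroSums m X)) (sym (count≡zeroSums (3 * p ∸ 1) X))
                            (zeroSums-p∸1≡zeroSums-3p∸1 length-X (count≡0⇒ZeroSumFree {X} count≡0))
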